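{- Let $G$ be a $2$-connected graph and let $X,Y$ be two docsets of $G$ with $X\subsetneq Y$. Then there exists a vertex $v\in Y\setminus X$ such that $X\cup\{v\}$ is a docset of $G$.
   Context: A docset of $G$ is a set $S\subseteq V(G)$ such that both $G[S]$ and $G[V(G)\setminus S]$ are connected. -}

module Defs where

open import Data.Nat using (ℕ; _≥_)
open import Data.Fin using (Fin)
open import Data.Fin.Subset using (Subset; _∈_; _∉_; Nonempty; ∁; _-_)
open import Data.Product using (_×_; ∃)
open import Relation.Nullary using (¬_)
open import Relation.Binary.PropositionalEquality using (_≡_)

record Graph (n : ℕ) : Set₁ where
  field
    Adj   : Fin n → Fin n → Set
    sym   : ∀ {u v} → Adj u v → Adj v u
    irrefl : ∀ {u} → ¬ Adj u u

open Graph public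

data WalkIn {n : ℕ} (G : Graph n) (S : Subset n) : Fin n → Fin n → Set where
  [_]  : ∀ {u} → u ∈ S → WalkIn G S u u
  _∷_  : ∀ {u w v} → u ∈ S → Adj G u w × WalkIn G S w v → WalkIn G S u v

Connected : ∀ {n} → Graph n → Subset n → Set
Connected G S = Nonempty S × (∀ u v → u ∈ S → v ∈ S → WalkIn G S u v)

Full : ∀ n → Subset n
Full n = ∁ (Data.Fin.Subset.⊥)

TwoConnected : ∀ {n} → Graph n → Set
TwoConnected {n} G = (n ≥ 3) × Connected G (Full n) × (∀ v → Connected G (Full n - v))

Docset : ∀ {n} → Graph n → Subset n → Set
Docset G S = Connected G S × Connected G (∁ S)

-- Fix z outside Y and call a ∈ Y ∖ X a candidate if it has a neighbour in X. For a
-- candidate a let Comp a be the component of z in G − X − a; take a candidate with Comp a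
-- maximal. If some vertex u of G − X − a were missing from Comp a, then on a walk from u
-- to z in G − a the edge pq entering X ∪ Comp a would have q ∈ X, so p is a candidate
-- (p ∈ Y because z reaches all of G − Y inside G − X − a), and Comp p ⊋ Comp a since it
-- also contains a. Hence G − X − a = Comp a is connected, and so is G[X ∪ {a}].
--
-- Adjacency in a Graph need not be decidable, which computing components requires, so
-- the argument is run in the spanning subgraph formed by the edges of the walks that
-- witness the hypotheses.

module Submission where

open import Defs
open import Data.Nat using (ℕ)
open import Data.Fin using (Fin; _≟_)
open import Data.Fin.Properties using (any?)
open import Data.Fin.Subset using (Subset; _∈_; _∉_; _⊆_; _⊂_; _⊃_; _∪_; ⁅_⁆; ∁; _─_; _-_; outside)
open import Data.Fin.Subset.Properties
  using ( _∈?_; x∈∁p⇒x∉p; x∉p⇒x∈∁p; x∈p∪q⁻; x∈p∪q⁺; p⊆p∪q; x∈⁅x⁆; x∈⁅y⁆⇒x≡y; x∉⁅y⁆⇒x≢y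
        ; p─q⊆p; x∈p∧x≢y⇒x∈p-y; ∉⊥)
open import Data.Fin.Subset.Induction using (Acc; acc; ⊃-wellFounded)
open import Data.List using (List; []; _∷_; map; concatMap; allFin)
open import Data.List.Relation.Unary.Any using (here; there)
open import Data.List.Membership.Propositional using (lose) renaming (_∈_ to _∈ₗ_)
open import Data.List.Membership.Propositional.Properties
  using (∈-map⁺; ∈-map⁻; ∈-concatMap⁺; ∈-allFin)
open import Data.List.Relation.Binary.Subset.Propositional using () renaming (_⊆_ to _⊆ₗ_)
open import Data.Product using (Σ; ∃; ∃₂; _×_; _,_; proj₁; proj₂; uncurry; map₂)
open import Data.Product.Properties using (≡-dec)
open import Data.Sum using (_⊎_; inj₁; inj₂; [_,_]′; swap)
open import Data.Vec using (_∷_)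
import Data.Vec as Vec
open import Function using (_∘_)
open import Relation.Binary using (Rel; Decidable; Sym; _⇒_)
open import Relation.Binary.Construct.Closure.ReflexiveTransitive
  using (Star; ε; _◅_; _◅◅_; reverse; return)
import Relation.Binary.Construct.Closure.ReflexiveTransitive as Star
open import Relation.Binary.PropositionalEquality using (_≡_; _≢_; refl) renaming (sym to ≡-sym)
open import Relation.Nullary using (¬_; Dec; yes; no; contradiction)
open import Relation.Nullary.Decidable using (map′; _×-dec_; _⊎-dec_; ¬?; decidable-stable)
open import Relation.Unary using (Pred) renaming (Decidable to Decidable₁)
import Data.List.Membership.DecPropositional as DecMembership

private
  variable
    n : ℕ

x∈p─q⇒x∉q : ∀ {x : Fin n} (p q : Subset n) → x ∈ p ─ q → x ∉ q
x∈p─q⇒x∉q (_ ∷ p) (outside ∷ q) Vec.here       = λ ()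
x∈p─q⇒x∉q (_ ∷ p) (_ ∷ q)       (Vec.there x∈) = λ { (Vec.there x∈q) → x∈p─q⇒x∉q p q x∈ x∈q }

x∈p-y⇒x≢y : ∀ {x y : Fin n} (p : Subset n) → x ∈ p - y → x ≢ y
x∈p-y⇒x≢y {y = y} p x∈ = x∉⁅y⁆⇒x≢y (x∈p─q⇒x∉q p ⁅ y ⁆ x∈)

star-crossing : ∀ {a b ℓ} {I : Set a} {T : Rel I b} {B : Pred I ℓ} → Decidable₁ B →
                ∀ {u v} → Star T u v → ¬ B u → B v → ∃₂ λ p q → ¬ B p × B q × T p q
star-crossing B? ε ¬Bu Bv = contradiction Bv ¬Bu
star-crossing B? (_◅_ {j = w} t rest) ¬Bu Bv with B? w
... | yes Bw  = _ , _ , ¬Bu , Bw , t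
... | no  ¬Bw = star-crossing B? rest ¬Bw Bv

record Adjacent (G : Graph n) (S : Subset n) (x y : Fin n) : Set where
  constructor edge
  field
    source∈ : x ∈ S
    target∈ : y ∈ S
    adjacent : Adj G x y

Reachable : Graph n → Subset n → Rel (Fin n) _
Reachable G S = Star (Adjacent G S)

_⊑_ : Graph n → Graph n → Set
H ⊑ G = ∀ {u v} → Adj H u v → Adj G u v

module _ {G : Graph n} {S : Subset n} where

  adjacent-sym : Sym (Adjacent G S) (Adjacent G S)
  adjacent-sym (edge x∈S y∈S e) = edge y∈S x∈S (sym G e)

  reachable-sym : Sym (Reachable G S) (Reachable G S)
  reachable-sym = reverse adjacent-sym

  reachable-end : ∀ {x y} → x ∈ S → Reachable G S x y → y ∈ S
  reachable-end x∈S ε                  = x∈S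
  reachable-end _   (edge _ w∈S _ ◅ r) = reachable-end w∈S r

  reachable-mono : ∀ {T} → S ⊆ T → Reachable G S ⇒ Reachable G T
  reachable-mono S⊆T = Star.map λ (edge x∈S y∈S e) → edge (S⊆T x∈S) (S⊆T y∈S) e

  walkIn-start : ∀ {u v} → WalkIn G S u v → u ∈ S
  walkIn-start [ u∈S ]   = u∈S
  walkIn-start (u∈S ∷ _) = u∈S

  fromWalkIn : ∀ {u v} → WalkIn G S u v → Reachable G S u v
  fromWalkIn [ _ ]           = ε
  fromWalkIn (u∈S ∷ (e , w)) = edge u∈S (walkIn-start w) e ◅ fromWalkIn w

  toWalkIn : ∀ {u v} → u ∈ S → Reachable G S u v → WalkIn G S u v
  toWalkIn u∈S ε                   = [ u∈S ]
  toWalkIn u∈S (edge _ w∈S e ◅ r) = u∈S ∷ (e , toWalkIn w∈S r)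

  connected⇒reachable : Connected G S → ∀ {u v} → u ∈ S → v ∈ S → Reachable G S u v
  connected⇒reachable (_ , walk) u∈S v∈S = fromWalkIn (walk _ _ u∈S v∈S)

  hub⇒connected : ∀ {z} → z ∈ S → (∀ {u} → u ∈ S → Reachable G S z u) → Connected G S
  hub⇒connected z∈S reach =
    (_ , z∈S) , λ u v u∈S v∈S → toWalkIn u∈S (reachable-sym (reach u∈S) ◅◅ reach v∈S)

module _ {H G : Graph n} (H⊑G : H ⊑ G) where

  reachable-subgraph : ∀ {S} → Reachable H S ⇒ Reachable G S
  reachable-subgraph = Star.map λ (edge x∈S y∈S e) → edge x∈S y∈S (H⊑G e)

  connected-subgraph : ∀ {S} → Connected H S → Connected G S
  connected-subgraph c@((s , s∈S) , _) =
    hub⇒connected s∈S λ u∈S → reachable-subgraph (connected⇒reachable c s∈S u∈S)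

  docset-subgraph : ∀ {S} → Docset H S → Docset G S
  docset-subgraph (c , c') = connected-subgraph c , connected-subgraph c'

Closed : Graph n → Subset n → Subset n → Set
Closed G S A = ∀ {x y} → x ∈ A → Adjacent G S x y → y ∈ A

module _ {G : Graph n} {S A : Subset n} (closed : Closed G S A) where

  reachable-within : ∀ {x y} → x ∈ A → Reachable G S x y → Reachable G A x y
  reachable-within x∈A ε                      = ε
  reachable-within x∈A (step@(edge _ _ e) ◅ r) =
    edge x∈A (closed x∈A step) e ◅ reachable-within (closed x∈A step) r

  closed-reachable : ∀ {x y} → x ∈ A → Reachable G S x y → y ∈ A
  closed-reachable x∈A r = reachable-end {G = G} x∈A (reachable-within x∈A r)

record Component (G : Graph n) (S : Subset n) (z : Fin n) : Set where
  field
    members   : Subset n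
    root      : z ∈ members
    reachable : ∀ {x} → x ∈ members → Reachable G S z x
    closed    : Closed G S members

  contains : ∀ {x} → Reachable G S z x → x ∈ members
  contains = closed-reachable {G = G} {S = S} closed root

  reachable-inside : ∀ {x} → x ∈ members → Reachable G members z x
  reachable-inside x∈ = reachable-within {G = G} {S = S} closed root (reachable x∈)

module _ (G : Graph n) (adj? : Decidable (Adj G)) (S : Subset n) where

  adjacent? : Decidable (Adjacent G S)
  adjacent? x y = map′ (λ (x∈S , y∈S , e) → edge x∈S y∈S e) (λ (edge x∈S y∈S e) → x∈S , y∈S , e)
                       (x ∈? S ×-dec y ∈? S ×-dec adj? x y)

  private
    grow : ∀ {z} (C : Subset n) → Acc _⊃_ C → z ∈ C → (∀ {x} → x ∈ C → Reachable G S z x) →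
           Component G S z
    grow {z} C (acc larger) z∈C reach
      with any? (λ x → any? (λ y → x ∈? C ×-dec ¬? (y ∈? C) ×-dec adjacent? x y))
    ... | no none = record
      { members = C ; root = z∈C ; reachable = reach
      ; closed = λ {x} {y} x∈C step →
          decidable-stable (y ∈? C) λ y∉C → none (x , y , x∈C , y∉C , step) }
    ... | yes (x , y , x∈C , y∉C , step) =
      grow (C ∪ ⁅ y ⁆) (larger (p⊆p∪q _ , y , y∈C∪y , y∉C)) (p⊆p∪q _ z∈C) reach′
      where
      y∈C∪y : y ∈ C ∪ ⁅ y ⁆
      y∈C∪y = x∈p∪q⁺ (inj₂ (x∈⁅x⁆ y))

      reach′ : ∀ {w} → w ∈ C ∪ ⁅ y ⁆ → Reachable G S z w
      reach′ w∈ with x∈p∪q⁻ C ⁅ y ⁆ w∈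
      ... | inj₁ w∈C = reach w∈C
      ... | inj₂ w∈y with x∈⁅y⁆⇒x≡y y w∈y
      ...   | refl = reach x∈C ◅◅ return step

  -- abstract: letting the well-founded recursion unfold makes type checking the theorem very slow.
  abstract
    component : (z : Fin n) → Component G S z
    component z = grow ⁅ z ⁆ (⊃-wellFounded _) (x∈⁅x⁆ z) λ x∈z → reach-root (x∈⁅y⁆⇒x≡y z x∈z)
      where
      reach-root : ∀ {x} → x ≡ z → Reachable G S z x
      reach-root refl = ε

Edge : Graph n → Set
Edge {n} G = Σ (Fin n × Fin n) (uncurry (Adj G))

module _ (G : Graph n) (L : List (Edge G)) where

  private
    Listed : Fin n → Fin n → Set
    Listed u v = (u , v) ∈ₗ map proj₁ L

    listed⇒adj : ∀ {u v} → Listed u v → Adj G u v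
    listed⇒adj uv∈ with ∈-map⁻ proj₁ uv∈
    ... | (_ , e) , _ , refl = e

  restrictTo : Graph n
  restrictTo = record
    { Adj    = λ u v → Listed u v ⊎ Listed v u
    ; sym    = swap
    ; irrefl = irrefl G ∘ [ listed⇒adj , listed⇒adj ]′
    }

  restrictTo-⊑ : restrictTo ⊑ G
  restrictTo-⊑ = [ listed⇒adj , sym G ∘ listed⇒adj ]′

  restrictTo-adj? : Decidable (Adj restrictTo)
  restrictTo-adj? u v = (u , v) ∈ₗ? map proj₁ L ⊎-dec (v , u) ∈ₗ? map proj₁ L
    where open DecMembership (≡-dec _≟_ _≟_) using () renaming (_∈?_ to _∈ₗ?_)

module _ {G : Graph n} {S : Subset n} where

  walkEdges : ∀ {u v} → Reachable G S u v → List (Edge G)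
  walkEdges ε = []
  walkEdges (_◅_ {i = u} {j = w} (edge _ _ e) r) = ((u , w) , e) ∷ walkEdges r

  restrictWalk : ∀ {L u v} (r : Reachable G S u v) → walkEdges r ⊆ₗ L →
                 Reachable (restrictTo G L) S u v
  restrictWalk ε                     _   = ε
  restrictWalk (edge u∈S w∈S _ ◅ r) sub =
    edge u∈S w∈S (inj₁ (∈-map⁺ proj₁ (sub (here refl)))) ◅ restrictWalk r (sub ∘ there)

  module _ (c : Connected G S) where

    private
      hub : Fin n
      hub = proj₁ (proj₁ c)

      hub∈S : hub ∈ S
      hub∈S = proj₂ (proj₁ c)

      edgesTo : ∀ v → Dec (v ∈ S) → List (Edge G)
      edgesTo v (yes v∈S) = walkEdges (connected⇒reachable c hub∈S v∈S)
      edgesTo v (no _)    = []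

      restrictHubWalk : ∀ {L v} (d : Dec (v ∈ S)) → edgesTo v d ⊆ₗ L → v ∈ S →
                        Reachable (restrictTo G L) S hub v
      restrictHubWalk (yes v∈S) sub _   = restrictWalk (connected⇒reachable c hub∈S v∈S) sub
      restrictHubWalk (no v∉S)  _   v∈S = contradiction v∈S v∉S

    spanningEdges : List (Edge G)
    spanningEdges = concatMap (λ v → edgesTo v (v ∈? S)) (allFin n)

    connected-restrictTo : ∀ {L} → spanningEdges ⊆ₗ L → Connected (restrictTo G L) S
    connected-restrictTo sub = hub⇒connected hub∈S λ {v} v∈S →
      restrictHubWalk (v ∈? S) (λ e∈ → sub (∈-concatMap⁺ _ (lose (∈-allFin v) e∈))) v∈S

DecidableSpanningSubgraph : (G : Graph n) → List (∃ (Connected G)) → Set₁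
DecidableSpanningSubgraph {n} G W =
  ∃ λ (H : Graph n) → Decidable (Adj H) × H ⊑ G × (∀ {S c} → (S , c) ∈ₗ W → Connected H S)

sparsify : (G : Graph n) (W : List (∃ (Connected G))) → DecidableSpanningSubgraph G W
sparsify G W = restrictTo G L , restrictTo-adj? G L , restrictTo-⊑ G L ,
               λ c∈W → connected-restrictTo _ λ e∈ → ∈-concatMap⁺ _ (lose c∈W e∈)
  where
  L : List (Edge G)
  L = concatMap (spanningEdges ∘ proj₂) W

module DocsetExtension
  (G : Graph n) (adj? : Decidable (Adj G)) (cut-connected : ∀ a → Connected G (Full n - a))
  {X Y : Subset n} (dX : Docset G X) (dY : Docset G Y) (X⊂Y : X ⊂ Y) where

  private
    X⊆Y : X ⊆ Y
    X⊆Y = proj₁ X⊂Y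

    z : Fin n
    z = proj₁ (proj₁ (proj₂ dY))

    z∉Y : z ∉ Y
    z∉Y = x∈∁p⇒x∉p (proj₂ (proj₁ (proj₂ dY)))

    Rest : Fin n → Subset n
    Rest a = ∁ X - a

    rest⁺ : ∀ {a x} → x ∉ X → x ≢ a → x ∈ Rest a
    rest⁺ x∉X x≢a = x∈p∧x≢y⇒x∈p-y (x∉p⇒x∈∁p x∉X) x≢a

    rest⁻∉ : ∀ {a x} → x ∈ Rest a → x ∉ X
    rest⁻∉ x∈ = x∈∁p⇒x∉p (p─q⊆p _ _ x∈)

    rest⁻≢ : ∀ {a x} → x ∈ Rest a → x ≢ a
    rest⁻≢ x∈ = x∈p-y⇒x≢y (∁ X) x∈

    ∁Y⊆Rest : ∀ {a} → a ∈ Y → ∁ Y ⊆ Rest a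
    ∁Y⊆Rest a∈Y x∈∁Y = rest⁺ (x∈∁p⇒x∉p x∈∁Y ∘ X⊆Y) λ { refl → x∈∁p⇒x∉p x∈∁Y a∈Y }

    z∈Rest : ∀ {a} → a ∈ Y → z ∈ Rest a
    z∈Rest a∈Y = ∁Y⊆Rest a∈Y (proj₂ (proj₁ (proj₂ dY)))

    module Comp (a : Fin n) = Component (component G adj? (Rest a) z)

    Comp : Fin n → Subset n
    Comp = Comp.members

    comp⊆rest : ∀ {a} → a ∈ Y → Comp a ⊆ Rest a
    comp⊆rest {a} a∈Y x∈ = reachable-end {G = G} (z∈Rest a∈Y) (Comp.reachable a x∈)

    a∉comp : ∀ {a} → a ∈ Y → a ∉ Comp a
    a∉comp a∈Y a∈ = rest⁻≢ (comp⊆rest a∈Y a∈) refl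

    Candidate : Fin n → Set
    Candidate a = a ∈ Y × a ∉ X × ∃ λ x → x ∈ X × Adj G a x

    z∉X : z ∉ X
    z∉X = z∉Y ∘ X⊆Y

    reach∁X : ∀ {x} → x ∉ X → Reachable G (∁ X) z x
    reach∁X x∉X = connected⇒reachable (proj₂ dX) (x∉p⇒x∈∁p z∉X) (x∉p⇒x∈∁p x∉X)

    reach∁Y : ∀ {x} → x ∉ Y → Reachable G (∁ Y) z x
    reach∁Y x∉Y = connected⇒reachable (proj₂ dY) (proj₂ (proj₁ (proj₂ dY))) (x∉p⇒x∈∁p x∉Y)

    reach-avoiding : ∀ {a x} → a ∈ Y → x ≢ a → Reachable G (Full n - a) x z
    reach-avoiding {a} a∈Y x≢a =
      connected⇒reachable (cut-connected a) (∈Full-a x≢a) (∈Full-a λ { refl → z∉Y a∈Y })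
      where
      ∈Full-a : ∀ {x} → x ≢ a → x ∈ Full n - a
      ∈Full-a = x∈p∧x≢y⇒x∈p-y (x∉p⇒x∈∁p ∉⊥)

    comp-mono : ∀ {a p} → a ∈ Y → p ∉ Comp a → Comp a ⊆ Comp p
    comp-mono {a} {p} a∈Y p∉A x∈A =
      Comp.contains p (reachable-mono A⊆Rest (Comp.reachable-inside a x∈A))
      where
      A⊆Rest : Comp a ⊆ Rest p
      A⊆Rest y∈A = rest⁺ (rest⁻∉ (comp⊆rest a∈Y y∈A)) λ { refl → p∉A y∈A }

    -- The walk from z to a inside G − X enters a from Comp a, hence from Comp p.
    comp-absorbs : ∀ {a p} → a ∈ Y → a ∉ X → p ∈ Y → a ≢ p → Comp a ⊆ Comp p → a ∈ Comp p
    comp-absorbs {a} {p} a∈Y a∉X p∈Y a≢p A⊆P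
      with star-crossing (_∈? Comp a) (reachable-sym (reach∁X a∉X)) (a∉comp a∈Y) (Comp.root a)
    ... | c , d , c∉A , d∈A , edge c∈∁X _ e with c ≟ a
    ...   | yes refl =
      Comp.closed p (A⊆P d∈A) (edge (comp⊆rest p∈Y (A⊆P d∈A)) (rest⁺ a∉X a≢p) (sym G e))
    ...   | no c≢a = contradiction
      (Comp.closed a d∈A (edge (comp⊆rest a∈Y d∈A) (rest⁺ (x∈∁p⇒x∉p c∈∁X) c≢a) (sym G e))) c∉A

    enlarge : ∀ {a u} → Candidate a → u ∈ Rest a → u ∉ Comp a →
              ∃ λ p → Candidate p × Comp a ⊂ Comp p
    enlarge {a} {u} (a∈Y , a∉X , _) u∈R u∉A
      with star-crossing (λ x → x ∈? X ⊎-dec x ∈? Comp a) (reach-avoiding a∈Y (rest⁻≢ u∈R))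
                         [ rest⁻∉ u∈R , u∉A ]′ (inj₂ (Comp.root a))
    ... | p , q , ¬Bp , Bq , edge p∈ _ e =
      p , (p∈Y , p∉X , q , q∈X , e) ,
      A⊆P , a , comp-absorbs a∈Y a∉X p∈Y (p≢a ∘ ≡-sym) A⊆P , a∉comp a∈Y
      where
      p∉X : p ∉ X
      p∉X = ¬Bp ∘ inj₁

      p∉A : p ∉ Comp a
      p∉A = ¬Bp ∘ inj₂

      p≢a : p ≢ a
      p≢a = x∈p-y⇒x≢y (Full n) p∈

      q∈X : q ∈ X
      q∈X = [ (λ q∈X → q∈X) , (λ q∈A → contradiction
                (Comp.closed a q∈A (edge (comp⊆rest a∈Y q∈A) (rest⁺ p∉X p≢a) (sym G e))) p∉A) ]′ Bq

      p∈Y : p ∈ Y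
      p∈Y = decidable-stable (p ∈? Y) λ p∉Y →
        p∉A (Comp.contains a (reachable-mono (∁Y⊆Rest a∈Y) (reach∁Y p∉Y)))

      A⊆P : Comp a ⊆ Comp p
      A⊆P = comp-mono a∈Y p∉A

    descend : ∀ {a} → Candidate a → Acc _⊃_ (Comp a) → ∃ λ v → Candidate v × Rest v ⊆ Comp v
    descend {a} ca (acc larger) with any? (λ u → u ∈? Rest a ×-dec ¬? (u ∈? Comp a))
    ... | yes (u , u∈R , u∉A) with enlarge ca u∈R u∉A
    ...   | p , cp , A⊂P = descend cp (larger A⊂P)
    descend {a} ca _ | no none =
      a , ca , λ {u} u∈R → decidable-stable (u ∈? Comp a) λ u∉A → none (u , u∈R , u∉A)

    initial : ∃ Candidate
    initial with proj₂ X⊂Y | proj₁ (proj₁ dX)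
    ... | y , y∈Y , y∉X | x , x∈X
      with star-crossing (_∈? X) (connected⇒reachable (proj₁ dY) y∈Y (X⊆Y x∈X)) y∉X x∈X
    ...   | a , q , a∉X , q∈X , edge a∈Y _ e = a , a∈Y , a∉X , q , q∈X , e

    extension-docset : ∀ {v} → Candidate v → Rest v ⊆ Comp v → Docset G (X ∪ ⁅ v ⁆)
    extension-docset {v} (v∈Y , v∉X , q , q∈X , e) covered =
      hub⇒connected (X⊆X∪v q∈X) reach-X∪v ,
      hub⇒connected (rest⊆∁ (z∈Rest v∈Y))
        λ u∈ → reachable-mono rest⊆∁ (Comp.reachable v (covered (∁⊆rest u∈)))
      where
      X⊆X∪v : X ⊆ X ∪ ⁅ v ⁆
      X⊆X∪v = p⊆p∪q _

      v∈X∪v : v ∈ X ∪ ⁅ v ⁆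
      v∈X∪v = x∈p∪q⁺ (inj₂ (x∈⁅x⁆ v))

      reach-X∪v : ∀ {u} → u ∈ X ∪ ⁅ v ⁆ → Reachable G (X ∪ ⁅ v ⁆) q u
      reach-X∪v u∈ with x∈p∪q⁻ X ⁅ v ⁆ u∈
      ... | inj₁ u∈X = reachable-mono X⊆X∪v (connected⇒reachable (proj₁ dX) q∈X u∈X)
      ... | inj₂ u∈v with x∈⁅y⁆⇒x≡y v u∈v
      ...   | refl = return (edge (X⊆X∪v q∈X) v∈X∪v (sym G e))

      ∁⊆rest : ∁ (X ∪ ⁅ v ⁆) ⊆ Rest v
      ∁⊆rest u∈ = rest⁺ (x∈∁p⇒x∉p u∈ ∘ X⊆X∪v) λ { refl → x∈∁p⇒x∉p u∈ v∈X∪v }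

      rest⊆∁ : Rest v ⊆ ∁ (X ∪ ⁅ v ⁆)
      rest⊆∁ u∈ = x∉p⇒x∈∁p λ u∈X∪v →
        [ rest⁻∉ u∈ , rest⁻≢ u∈ ∘ x∈⁅y⁆⇒x≡y v ]′ (x∈p∪q⁻ X ⁅ v ⁆ u∈X∪v)

  docset-extension : ∃ λ v → v ∈ Y × v ∉ X × Docset G (X ∪ ⁅ v ⁆)
  docset-extension with initial
  ... | a , ca with descend ca (⊃-wellFounded (Comp a))
  ...   | v , cv@(v∈Y , v∉X , _) , covered = v , v∈Y , v∉X , extension-docset cv covered

lemma5p8 : ∀ {n} (G : Graph n) → TwoConnected G →
    (X Y : Subset n) → Docset G X → Docset G Y → X ⊂ Y →
    ∃ λ (v : Fin n) → v ∈ Y × v ∉ X × Docset G (X ∪ ⁅ v ⁆)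
lemma5p8 {n} G (_ , _ , cut-connected) X Y (cX , c∁X) (cY , c∁Y) X⊂Y
  with sparsify G ((X , cX) ∷ (∁ X , c∁X) ∷ (Y , cY) ∷ (∁ Y , c∁Y)
                   ∷ map (λ a → Full n - a , cut-connected a) (allFin n))
... | H , adj? , H⊑G , connected =
  map₂ (map₂ (map₂ (docset-subgraph H⊑G)))
    (DocsetExtension.docset-extension H adj?
      (λ a → connected (there (there (there (there (∈-map⁺ _ (∈-allFin a)))))))
      (connected (here refl) , connected (there (here refl)))
      (connected (there (there (here refl))) , connected (there (there (there (here refl)))))
      X⊂Y)
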